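{- For every $x\in\mathbb{N}\setminus\{0\}$, $\beta(x)=\beta\left(x-f_{\gamma(x)}\right)+1$.
   Context: $\{f_n\}$ is the Fibonacci sequence ($f_0=0$, $f_1=1$, $f_{n+2}=f_{n+1}+f_n$). For $x\in\mathbb{N}$, $\beta(x)=\min\{\sum_{i=2}^{l} b_i \mid x=\sum_{i=2}^{l} b_i f_i,\ (b_2,\ldots,b_l)\in\mathbb{N}^{l-1},\ l\geq 2\}$, and $\gamma(x)=\max\{l\in\mathbb{N}\mid f_l\leq x\}$ (so $\gamma(0)=0$). -}

module Defs where

open import Data.Nat using (ℕ; zero; suc; _+_; _*_; _≤_)
open import Data.List using (List; []; _∷_)
open import Data.Nat.ListAction using (sum)
open import Data.Product using (Σ; _×_; _,_)
open import Relation.Binary.PropositionalEquality using (_≡_)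

fib : ℕ → ℕ
fib zero = 0
fib (suc zero) = 1
fib (suc (suc n)) = fib (suc n) + fib n

valFrom : ℕ → List ℕ → ℕ
valFrom i [] = 0
valFrom i (b ∷ bs) = b * fib i + valFrom (suc i) bs

-- a representation (b_2, ..., b_l) (l ≥ 2; the empty list corresponds to l = 1,
-- i.e. the empty sum, used for x = 0) has value Σ_{i=2}^l b_i f_i
value : List ℕ → ℕ
value bs = valFrom 2 bs

weight : List ℕ → ℕ
weight bs = sum bs

IsBeta : ℕ → ℕ → Set
IsBeta x k =
  Σ (List ℕ) (λ bs → value bs ≡ x × weight bs ≡ k)
  × (∀ (bs : List ℕ) → value bs ≡ x → k ≤ weight bs)

IsGamma : ℕ → ℕ → Set
IsGamma x l = fib l ≤ x × (∀ (m : ℕ) → fib m ≤ x → m ≤ l)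

-- β coincides with the number of terms of the Zeckendorf (greedy) representation:
-- the greedy representation has that weight, and adding one Fibonacci number to y
-- raises the Zeckendorf count of y by at most one, so by induction on a representation
-- its weight is at least the count of its value. The greedy representation of x starts
-- with f_{γ(x)} and continues with that of x − f_{γ(x)}.
module Submission where

open import Defs
open import Data.Nat
  using (ℕ; zero; suc; _+_; _*_; _∸_; _<_; _≤_; z≤n; s≤s; z<s; _<?_; less; equal; greater; compare)
open import Data.Nat.Properties
open import Data.Nat.Induction using (<-rec)
open import Data.Nat.ListAction using (sum)
open import Data.Nat.Tactic.RingSolver using (solve-∀)
open import Algebra.Properties.CommutativeSemigroup +-commutativeSemigroup using (x∙yz≈y∙xz)
open import Data.List using (List; []; _∷_)
open import Data.Product using (Σ; _×_; _,_)
open import Function using (_∘_)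
open import Relation.Nullary using (yes; no)
open import Relation.Nullary.Negation using (contradiction)
open import Relation.Binary using (tri<; tri≈; tri>)
open import Relation.Binary.PropositionalEquality

fib[1+n]>0 : ∀ n → 0 < fib (suc n)
fib[1+n]>0 zero    = z<s
fib[1+n]>0 (suc n) = ≤-trans (fib[1+n]>0 n) (m≤m+n _ _)

fib-≤-suc : ∀ n → fib n ≤ fib (suc n)
fib-≤-suc zero    = z≤n
fib-≤-suc (suc n) = m≤m+n _ _

fib-mono-≤ : ∀ {m n} → m ≤ n → fib m ≤ fib n
fib-mono-≤ {m} m≤n with m≤n⇒∃[o]m+o≡n m≤n
... | k , refl = fib-≤-+ k
  where
  fib-≤-+ : ∀ k → fib m ≤ fib (m + k)
  fib-≤-+ zero    rewrite +-identityʳ m = ≤-refl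
  fib-≤-+ (suc k) rewrite +-suc m k = ≤-trans (fib-≤-+ k) (fib-≤-suc (m + k))

fib[2+p]+r<fib[2+q] : ∀ {p q r} → p < q → r < fib (suc p) → fib (2 + p) + r < fib (2 + q)
fib[2+p]+r<fib[2+q] {p} p<q r< =
  <-≤-trans (+-monoʳ-< (fib (2 + p)) r<) (fib-mono-≤ (s≤s (s≤s p<q)))

leading-index-unique : ∀ {p q r s} → r < fib (suc p) → s < fib (suc q) →
                       fib (2 + p) + r ≡ fib (2 + q) + s → p ≡ q
leading-index-unique {p} {q} {r} {s} r< s< eq with <-cmp p q
... | tri< p<q _ _ = contradiction eq (<⇒≢ (<-≤-trans (fib[2+p]+r<fib[2+q] p<q r<) (m≤m+n _ s)))
... | tri≈ _ p≡q _ = p≡q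
... | tri> _ _ q<p = contradiction (sym eq) (<⇒≢ (<-≤-trans (fib[2+p]+r<fib[2+q] q<p s<) (m≤m+n _ r)))

data Greedy : ℕ → Set where
  zero    : Greedy 0
  leading : ∀ p {r} → r < fib (suc p) → Greedy (fib (2 + p) + r)

greedy : ∀ y → Greedy y
greedy zero = zero
greedy (suc y) with greedy y
... | zero = leading 0 z<s
... | leading p {r} r< with suc r <? fib (suc p)
...   | yes 1+r< = subst Greedy (+-suc (fib (2 + p)) r) (leading p 1+r<)
...   | no 1+r≮ = subst Greedy fib[3+p]+0≡1+y (leading (suc p) (fib[1+n]>0 (suc p)))
  where
  fib[3+p]+0≡1+y : fib (3 + p) + 0 ≡ suc (fib (2 + p) + r)
  fib[3+p]+0≡1+y = begin
    fib (2 + p) + fib (suc p) + 0 ≡⟨ +-identityʳ _ ⟩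
    fib (2 + p) + fib (suc p)     ≡⟨ cong (fib (2 + p) +_) (sym (≤∧≮⇒≡ r< 1+r≮)) ⟩
    fib (2 + p) + suc r           ≡⟨ +-suc (fib (2 + p)) r ⟩
    suc (fib (2 + p) + r)         ∎
    where open ≡-Reasoning

data Zeckendorf : ℕ → Set where
  []   : Zeckendorf 0
  cons : ∀ p {r} → r < fib (suc p) → Zeckendorf r → Zeckendorf (fib (2 + p) + r)

length : ∀ {y} → Zeckendorf y → ℕ
length []           = 0
length (cons _ _ z) = suc (length z)

zeckendorf : ∀ y → Zeckendorf y
zeckendorf = <-rec Zeckendorf (λ y → extend (greedy y))
  where
  extend : ∀ {y} → Greedy y → (∀ {z} → z < y → Zeckendorf z) → Zeckendorf y
  extend zero                  rec = []
  extend (leading p {r} r<) rec = cons p r< (rec (m<n+m r (fib[1+n]>0 (suc p))))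

length-unique : ∀ {x x′} (z : Zeckendorf x) (z′ : Zeckendorf x′) → x ≡ x′ → length z ≡ length z′
length-unique [] [] _ = refl
length-unique [] (cons q {s} _ _) eq =
  contradiction (sym eq) (m<n⇒n≢0 (<-≤-trans (fib[1+n]>0 (suc q)) (m≤m+n _ s)))
length-unique (cons p {r} _ _) [] eq =
  contradiction eq (m<n⇒n≢0 (<-≤-trans (fib[1+n]>0 (suc p)) (m≤m+n _ r)))
length-unique (cons p r< z) (cons q s< z′) eq with leading-index-unique {p} {q} r< s< eq
... | refl = cong suc (length-unique z z′ (+-cancelˡ-≡ (fib (2 + p)) _ _ eq))

zeck : ℕ → ℕ
zeck y = length (zeckendorf y)

zeck≡length : ∀ {y} (z : Zeckendorf y) → zeck y ≡ length z
zeck≡length z = length-unique (zeckendorf _) z refl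

zeck-0 : zeck 0 ≡ 0
zeck-0 = zeck≡length []

zeck-leading : ∀ p {r} → r < fib p → zeck (fib (suc p) + r) ≡ suc (zeck r)
zeck-leading (suc p) {r} r< = zeck≡length (cons p r< (zeckendorf r))

incrementAt : ℕ → List ℕ → List ℕ
incrementAt zero    []       = 1 ∷ []
incrementAt zero    (b ∷ bs) = suc b ∷ bs
incrementAt (suc n) []       = 0 ∷ incrementAt n []
incrementAt (suc n) (b ∷ bs) = b ∷ incrementAt n bs

valFrom-incrementAt : ∀ n i bs → valFrom i (incrementAt n bs) ≡ fib (i + n) + valFrom i bs
valFrom-incrementAt zero i [] rewrite +-identityʳ i = cong (_+ 0) (*-identityˡ (fib i))
valFrom-incrementAt zero i (b ∷ bs) rewrite +-identityʳ i = +-assoc (fib i) _ _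
valFrom-incrementAt (suc n) i [] rewrite +-suc i n = valFrom-incrementAt n (suc i) []
valFrom-incrementAt (suc n) i (b ∷ bs) rewrite +-suc i n =
  trans (cong (b * fib i +_) (valFrom-incrementAt n (suc i) bs))
        (x∙yz≈y∙xz (b * fib i) (fib (suc (i + n))) (valFrom (suc i) bs))

sum-incrementAt : ∀ n bs → sum (incrementAt n bs) ≡ suc (sum bs)
sum-incrementAt zero    []       = refl
sum-incrementAt zero    (b ∷ bs) = refl
sum-incrementAt (suc n) []       = sum-incrementAt n []
sum-incrementAt (suc n) (b ∷ bs) = trans (cong (b +_) (sum-incrementAt n bs)) (+-suc b (sum bs))

representation : ∀ {y} (z : Zeckendorf y) → Σ (List ℕ) λ bs → value bs ≡ y × weight bs ≡ length z
representation [] = [] , refl , refl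
representation (cons p r< z) with representation z
... | bs , value≡ , weight≡ =
  incrementAt p bs ,
  trans (valFrom-incrementAt p 2 bs) (cong (fib (2 + p) +_) value≡) ,
  trans (sum-incrementAt p bs) (cong suc weight≡)

FibAddBound : ℕ → Set
FibAddBound y = ∀ j → zeck (fib j + y) ≤ suc (zeck y)

zeck-≤-zeck-fib[1+p]+ : ∀ p {v} → v < fib (2 + p) → (∀ {u} → u ≤ v → FibAddBound u) →
                   zeck v ≤ zeck (fib (suc p) + v)
zeck-≤-zeck-fib[1+p]+ p {v} v< ih with v <? fib p
... | yes v<fib[p] = ≤-trans (n≤1+n _) (≤-reflexive (sym (zeck-leading p v<fib[p])))
... | no v≮fib[p] with m≤n⇒∃[o]m+o≡n (≮⇒≥ v≮fib[p])
...   | u , refl = begin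
  zeck (fib p + u)                 ≤⟨ ih (m≤n+m u (fib p)) p ⟩
  suc (zeck u)                     ≡⟨ sym (zeck-leading (suc p) u<fib[1+p]) ⟩
  zeck (fib (2 + p) + u)           ≡⟨ cong zeck (+-assoc (fib (suc p)) (fib p) u) ⟩
  zeck (fib (suc p) + (fib p + u)) ∎
  where
  open ≤-Reasoning
  u<fib[1+p] : u < fib (suc p)
  u<fib[1+p] = +-cancelˡ-< (fib p) u (fib (suc p))
                 (<-≤-trans v< (≤-reflexive (+-comm (fib (suc p)) (fib p))))

module _ (p : ℕ) {r : ℕ} (r< : r < fib (suc p))
         (ih : ∀ {z} → z < fib (2 + p) + r → FibAddBound z) where

  private
    zeck-Y : zeck (fib (2 + p) + r) ≡ suc (zeck r)
    zeck-Y = zeck-leading (suc p) r<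

    ih-r : FibAddBound r
    ih-r = ih (m<n+m r (fib[1+n]>0 (suc p)))

  zeck-add-above : ∀ q → p < q → zeck (fib (3 + q) + (fib (2 + p) + r)) ≤ suc (zeck (fib (2 + p) + r))
  zeck-add-above q p<q = ≤-reflexive (zeck-leading (2 + q) (fib[2+p]+r<fib[2+q] p<q r<))

  zeck-add-next : zeck (fib (3 + p) + (fib (2 + p) + r)) ≤ suc (zeck (fib (2 + p) + r))
  zeck-add-next = begin
    zeck (fib (3 + p) + (fib (2 + p) + r)) ≡⟨ cong zeck (sym (+-assoc (fib (3 + p)) (fib (2 + p)) r)) ⟩
    zeck (fib (4 + p) + r)                 ≡⟨ zeck-leading (3 + p) (<-≤-trans r< (fib-mono-≤ (m≤n+m (suc p) 2))) ⟩
    suc (zeck r)                           ≡⟨ sym zeck-Y ⟩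
    zeck (fib (2 + p) + r)                 ≤⟨ n≤1+n _ ⟩
    suc (zeck (fib (2 + p) + r))           ∎
    where open ≤-Reasoning

  zeck-add-same : zeck (fib (2 + p) + (fib (2 + p) + r)) ≤ suc (zeck (fib (2 + p) + r))
  zeck-add-same = begin
    zeck (fib (2 + p) + (fib (2 + p) + r)) ≡⟨ cong zeck (doubling (fib (suc p)) (fib p) r) ⟩
    zeck (fib (3 + p) + (fib p + r))       ≡⟨ zeck-leading (2 + p) fib[p]+r<fib[2+p] ⟩
    suc (zeck (fib p + r))                 ≤⟨ s≤s (ih-r p) ⟩
    suc (suc (zeck r))                     ≡⟨ cong suc (sym zeck-Y) ⟩
    suc (zeck (fib (2 + p) + r))           ∎
    where
    open ≤-Reasoning
    -- 2 f(p+2) = f(p+3) + f(p), read with a = f(p+1), b = f(p)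
    doubling : ∀ a b r → (a + b) + ((a + b) + r) ≡ ((a + b) + a) + (b + r)
    doubling = solve-∀
    fib[p]+r<fib[2+p] : fib p + r < fib (2 + p)
    fib[p]+r<fib[2+p] = <-≤-trans (+-monoʳ-< (fib p) r<) (≤-reflexive (+-comm (fib p) (fib (suc p))))

  private
    -- Either fib j + r stays below fib (1 + p), or it carries into fib (3 + p).
    zeck-add-below-remainder : ∀ j → fib j ≤ fib (suc p) →
                               zeck (fib j + (fib (2 + p) + r)) ≤ suc (zeck (fib j + r))
    zeck-add-below-remainder j fib[j]≤fib[1+p] with fib j + r <? fib (suc p)
    ... | yes fib[j]+r< = ≤-reflexive (begin
      zeck (fib j + (fib (2 + p) + r)) ≡⟨ cong zeck (x∙yz≈y∙xz (fib j) (fib (2 + p)) r) ⟩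
      zeck (fib (2 + p) + (fib j + r)) ≡⟨ zeck-leading (suc p) fib[j]+r< ⟩
      suc (zeck (fib j + r))           ∎)
      where open ≡-Reasoning
    ... | no fib[j]+r≮ with m≤n⇒∃[o]m+o≡n (≮⇒≥ fib[j]+r≮)
    ...   | v , fib[1+p]+v≡fib[j]+r = begin
      zeck (fib j + (fib (2 + p) + r)) ≡⟨ cong zeck carry ⟩
      zeck (fib (3 + p) + v)           ≡⟨ zeck-leading (2 + p) v<fib[2+p] ⟩
      suc (zeck v)                     ≤⟨ s≤s (zeck-≤-zeck-fib[1+p]+ p v<fib[2+p] (λ u≤v → ih (≤-<-trans u≤v v<Y))) ⟩
      suc (zeck (fib (suc p) + v))     ≡⟨ cong (suc ∘ zeck) fib[1+p]+v≡fib[j]+r ⟩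
      suc (zeck (fib j + r))           ∎
      where
      open ≤-Reasoning
      carry : fib j + (fib (2 + p) + r) ≡ fib (3 + p) + v
      carry = begin-equality
        fib j + (fib (2 + p) + r)            ≡⟨ x∙yz≈y∙xz (fib j) (fib (2 + p)) r ⟩
        fib (2 + p) + (fib j + r)            ≡⟨ cong (fib (2 + p) +_) (sym fib[1+p]+v≡fib[j]+r) ⟩
        fib (2 + p) + (fib (suc p) + v)      ≡⟨ sym (+-assoc (fib (2 + p)) (fib (suc p)) v) ⟩
        fib (3 + p) + v                      ∎
      v<fib[j] : v < fib j
      v<fib[j] = +-cancelˡ-< (fib (suc p)) v (fib j) (begin-strict
        fib (suc p) + v ≡⟨ fib[1+p]+v≡fib[j]+r ⟩
        fib j + r       <⟨ +-monoʳ-< (fib j) r< ⟩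
        fib j + fib (suc p) ≡⟨ +-comm (fib j) (fib (suc p)) ⟩
        fib (suc p) + fib j ∎)
      v<fib[2+p] : v < fib (2 + p)
      v<fib[2+p] = <-≤-trans v<fib[j] (≤-trans fib[j]≤fib[1+p] (m≤m+n _ _))
      v<Y : v < fib (2 + p) + r
      v<Y = <-≤-trans v<fib[2+p] (m≤m+n _ r)

  zeck-add-below : ∀ j → fib j ≤ fib (suc p) → zeck (fib j + (fib (2 + p) + r)) ≤ suc (zeck (fib (2 + p) + r))
  zeck-add-below j fib[j]≤fib[1+p] =
    ≤-trans (zeck-add-below-remainder j fib[j]≤fib[1+p]) (s≤s (≤-trans (ih-r j) (≤-reflexive (sym zeck-Y))))

zeck-fib[2+q]+ : ∀ {y} → Greedy y → (∀ {z} → z < y → FibAddBound z) →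
                 ∀ q → zeck (fib (2 + q) + y) ≤ suc (zeck y)
zeck-fib[2+q]+ zero _ q = ≤-reflexive (zeck-leading (suc q) (fib[1+n]>0 q))
zeck-fib[2+q]+ (leading p r<) ih q with compare q p
... | less q k          = zeck-add-below (suc (q + k)) r< ih (2 + q) (fib-mono-≤ (s≤s (s≤s (m≤m+n q k))))
... | equal p           = zeck-add-same p r< ih
... | greater p zero rewrite +-identityʳ p = zeck-add-next p r< ih
... | greater p (suc k) = zeck-add-above p r< ih (p + suc k) (m<m+n p z<s)

zeck-fib+≤ : ∀ j y → zeck (fib j + y) ≤ suc (zeck y)
zeck-fib+≤ j y = <-rec FibAddBound step y j
  where
  step : ∀ y → (∀ {z} → z < y → FibAddBound z) → FibAddBound y
  step y ih zero          = n≤1+n _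
  step y ih (suc zero)    = zeck-fib[2+q]+ (greedy y) ih 0   -- fib 1 = fib 2
  step y ih (suc (suc q)) = zeck-fib[2+q]+ (greedy y) ih q

zeck-valFrom≤sum : ∀ i bs → zeck (valFrom i bs) ≤ sum bs
zeck-valFrom≤sum i [] = ≤-reflexive zeck-0
zeck-valFrom≤sum i (b ∷ bs) = bound b
  where
  open ≤-Reasoning
  bound : ∀ b → zeck (b * fib i + valFrom (suc i) bs) ≤ b + sum bs
  bound zero    = zeck-valFrom≤sum (suc i) bs
  bound (suc b) = begin
    zeck (fib i + b * fib i + valFrom (suc i) bs)   ≡⟨ cong zeck (+-assoc (fib i) _ _) ⟩
    zeck (fib i + (b * fib i + valFrom (suc i) bs)) ≤⟨ zeck-fib+≤ i _ ⟩
    suc (zeck (b * fib i + valFrom (suc i) bs))     ≤⟨ s≤s (bound b) ⟩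
    suc b + sum bs                                  ∎

isBeta-zeck : ∀ x → IsBeta x (zeck x)
isBeta-zeck x = representation (zeckendorf x) ,
  λ bs value≡x → subst (λ y → zeck y ≤ weight bs) value≡x (zeck-valFrom≤sum 2 bs)

isBeta-unique : ∀ {x k k′} → IsBeta x k → IsBeta x k′ → k ≡ k′
isBeta-unique ((bs , value≡ , refl) , minimal) ((bs′ , value≡′ , refl) , minimal′) =
  ≤-antisym (minimal bs′ value≡′) (minimal′ bs value≡)

zeck-isGamma : ∀ {x l} → 0 < x → IsGamma x l → zeck x ≡ suc (zeck (x ∸ fib l))
zeck-isGamma {l = zero}    0<x (_ , maximal) = contradiction (maximal 2 0<x) λ ()
zeck-isGamma {l = suc zero} 0<x (_ , maximal) = contradiction (maximal 2 0<x) λ { (s≤s ()) }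
zeck-isGamma {x} {suc (suc p)} _ (fib[l]≤x , maximal) = begin
  zeck x                                  ≡⟨ cong zeck (sym (m+[n∸m]≡n fib[l]≤x)) ⟩
  zeck (fib (2 + p) + (x ∸ fib (2 + p)))  ≡⟨ zeck-leading (suc p) remainder< ⟩
  suc (zeck (x ∸ fib (2 + p)))            ∎
  where
  open ≡-Reasoning
  x<fib[3+p] : x < fib (3 + p)
  x<fib[3+p] = ≰⇒> (λ fib[3+p]≤x → 1+n≰n (maximal (3 + p) fib[3+p]≤x))
  remainder< : x ∸ fib (2 + p) < fib (suc p)
  remainder< = +-cancelˡ-< (fib (2 + p)) _ _
                 (subst (_< fib (3 + p)) (sym (m+[n∸m]≡n fib[l]≤x)) x<fib[3+p])

lemma19 : ∀ (x l k : ℕ) → 0 < x → IsGamma x l →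
    IsBeta (x ∸ fib l) k → IsBeta x (suc k)
lemma19 x l k 0<x isGamma isBeta = subst (IsBeta x) zeck[x]≡1+k (isBeta-zeck x)
  where
  zeck[x]≡1+k : zeck x ≡ suc k
  zeck[x]≡1+k = trans (zeck-isGamma 0<x isGamma) (cong suc (isBeta-unique (isBeta-zeck _) isBeta))
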